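{- Let $b$ be a legal queue behavior. Then there exists a canonical queue behavior $b_c$ such that $b$ and $b_c$ are observationally equivalent.
   Context: A queue event is a tuple $(u,m,d_{in},d_{out})$ with a globally unique identifier $u\in\mathbb{N}$ and method $m\in\{\mathtt{enq},\mathtt{deq}\}$; an enqueue event of value $x\in\mathbb{N}$ is written $\mathtt{enq}(x)$ and a dequeue event returning $x\in\mathbb{N}\cup\{\mathtt{NULL}\}$ is written $\mathtt{deq}(x)$. A queue behavior is a finite duplicate-free sequence of queue events. $\mathsf{LTS}_Q$ has states finite sequences over $\mathbb{N}$, initial state $\varepsilon$, and transitions $q\xrightarrow{\mathtt{enq}(x)}q\cdot x$, $x\cdot q'\xrightarrow{\mathtt{deq}(x)}q'$ ($x\in\mathbb{N}$), $\varepsilon\xrightarrow{\mathtt{deq}(\mathtt{NULL})}\varepsilon$. A behavior is legal if it is the label sequence of a run of $\mathsf{LTS}_Q$ from $\varepsilon$. Two behaviors $b_1,b_2$ are observationally equivalent if the subsequence of enqueue events of $b_1$ equals that of $b_2$ and the subsequence of dequeue events of $b_1$ equals that of $b_2$. A behavior is canonical if it has the form $\big((\mathtt{deq}(\mathtt{NULL}))^*\cdot\mathtt{enq}(x)\cdot\mathtt{deq}(x)\big)^*\cdot(\mathtt{deq}(\mathtt{NULL}))^*\cdot(\mathtt{enq}(x))^*$, where in each displayed pair $\mathtt{enq}(x)\cdot\mathtt{deq}(x)$ both events carry the same value $x\in\mathbb{N}$ (values may differ between pairs and among the trailing enqueues). -}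

module Defs where

open import Data.Nat using (ℕ)
open import Data.Bool using (Bool; true; false)
open import Data.Maybe using (Maybe; just; nothing)
open import Data.List using (List; []; _∷_; _++_; map)
open import Data.List.Relation.Unary.Unique.Propositional using (Unique)
open import Data.Product using (∃)
open import Relation.Binary.PropositionalEquality using (_≡_)

data Op : Set where
  enq : ℕ → Op
  deq : Maybe ℕ → Op

-- A queue event (u, m, d_in, d_out): identifier u ∈ ℕ, method and
-- its input/output value (recorded in the Op).
record Event : Set where
  constructor mkEvent
  field
    uid : ℕ
    op  : Op
open Event public

Behavior : Set
Behavior = List Event

DuplicateFree : Behavior → Set
DuplicateFree b = Unique (map uid b)

data Step : List ℕ → Op → List ℕ → Set where
  step-enq  : ∀ q x → Step q (enq x) (q ++ (x ∷ []))
  step-deq  : ∀ x q → Step (x ∷ q) (deq (just x)) q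
  step-null : Step [] (deq nothing) []

data Run : List ℕ → Behavior → List ℕ → Set where
  run-nil  : ∀ {q} → Run q [] q
  run-cons : ∀ {q q' q''} {e : Event} {b : Behavior} →
             Step q (op e) q' → Run q' b q'' → Run q (e ∷ b) q''

Legal : Behavior → Set
Legal b = ∃ λ q → Run [] b q

isEnq : Event → Bool
isEnq e with op e
... | enq _ = true
... | deq _ = false

enqs : Behavior → Behavior
enqs [] = []
enqs (e ∷ b) with isEnq e
... | true  = e ∷ enqs b
... | false = enqs b

deqs : Behavior → Behavior
deqs [] = []
deqs (e ∷ b) with isEnq e
... | true  = deqs b
... | false = e ∷ deqs b

ObsEquiv : Behavior → Behavior → Set
ObsEquiv b₁ b₂ = (enqs b₁ ≡ enqs b₂) × (deqs b₁ ≡ deqs b₂)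
  where open import Data.Product using (_×_)

-- Canonical form
--   ((deq NULL)* · enq(x) · deq(x))* · (deq NULL)* · (enq(x))*
-- EnqTail     : (enq(x))*
-- NullsThen P : (deq NULL)* followed by a word satisfying P
-- Canonical   : ((deq NULL)* enq(x) deq(x))* (deq NULL)* (enq(x))*
data EnqTail : Behavior → Set where
  et-nil  : EnqTail []
  et-cons : ∀ u x {b} → EnqTail b → EnqTail (mkEvent u (enq x) ∷ b)

data Canonical : Behavior → Set where
  c-tail : ∀ {b} → EnqTail b → Canonical b
  -- a deq(NULL) at the front (either inside a pair-block prefix or the final (deq NULL)*)
  c-null : ∀ u {b} → Canonical b → Canonical (mkEvent u (deq nothing) ∷ b)
  c-pair : ∀ u v x {b} → Canonical b →
           Canonical (mkEvent u (enq x) ∷ mkEvent v (deq (just x)) ∷ b)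

-- Split b into its enqueue subsequence E and dequeue subsequence D, and
-- interleave them again by placing every value-returning dequeue right after
-- the next pending enqueue, with NULL dequeues passed through.  Along any run
-- of the queue, initial contents ++ enqueued values = dequeued values ++ final
-- contents; from the empty queue the dequeued values are therefore a prefix of
-- the enqueued ones, which is exactly what makes each enqueue/dequeue pair of
-- the interleaving carry the same value.  The interleaving is a permutation of
-- b, hence duplicate-free, and its subsequences are again E and D.

module Submission where

open import Defs
open import Data.Product using (Σ; _×_; _,_)
open import Data.Nat using (ℕ)
open import Data.Maybe using (just; nothing)
open import Data.List using (List; []; _∷_; _++_; [_])
open import Data.List.Properties using (∷-injective; ++-assoc; ++-identityʳ)
open import Relation.Binary.PropositionalEquality
  using (_≡_; refl; sym; trans; cong; setoid; module ≡-Reasoning)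
open import Data.List.Relation.Binary.Permutation.Propositional
  using (_↭_; prep; ↭-sym; ↭-trans; ↭-refl; ↭⇒↭ₛ)
import Data.List.Relation.Binary.Permutation.Propositional.Properties as ↭
import Data.List.Relation.Binary.Permutation.Setoid.Properties as ↭ₛ

data Enqueues : Behavior → Set where
  []    : Enqueues []
  enq∷_ : ∀ {u x b} → Enqueues b → Enqueues (mkEvent u (enq x) ∷ b)

data Dequeues : Behavior → Set where
  []    : Dequeues []
  deq∷_ : ∀ {u m b} → Dequeues b → Dequeues (mkEvent u (deq m) ∷ b)

enqueued : Behavior → List ℕ
enqueued []                       = []
enqueued (mkEvent _ (enq x) ∷ b) = x ∷ enqueued b
enqueued (mkEvent _ (deq _) ∷ b) = enqueued b

dequeued : Behavior → List ℕ
dequeued []                              = []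
dequeued (mkEvent _ (enq _) ∷ b)        = dequeued b
dequeued (mkEvent _ (deq nothing) ∷ b)  = dequeued b
dequeued (mkEvent _ (deq (just x)) ∷ b) = x ∷ dequeued b

run-balance : ∀ {q b q′} → Run q b q′ → q ++ enqueued b ≡ dequeued b ++ q′
run-balance run-nil = ++-identityʳ _
run-balance (run-cons {e = mkEvent _ _} (step-enq q x) r) =
  trans (sym (++-assoc q [ x ] _)) (run-balance r)
run-balance (run-cons {e = mkEvent _ _} (step-deq x q) r) = cong (x ∷_) (run-balance r)
run-balance (run-cons {e = mkEvent _ _} step-null r) = run-balance r

enqs-Enqueues : ∀ b → Enqueues (enqs b)
enqs-Enqueues []                       = []
enqs-Enqueues (mkEvent _ (enq _) ∷ b) = enq∷ enqs-Enqueues b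
enqs-Enqueues (mkEvent _ (deq _) ∷ b) = enqs-Enqueues b

deqs-Dequeues : ∀ b → Dequeues (deqs b)
deqs-Dequeues []                       = []
deqs-Dequeues (mkEvent _ (enq _) ∷ b) = deqs-Dequeues b
deqs-Dequeues (mkEvent _ (deq _) ∷ b) = deq∷ deqs-Dequeues b

enqueued-enqs : ∀ b → enqueued (enqs b) ≡ enqueued b
enqueued-enqs []                       = refl
enqueued-enqs (mkEvent _ (enq x) ∷ b) = cong (x ∷_) (enqueued-enqs b)
enqueued-enqs (mkEvent _ (deq _) ∷ b) = enqueued-enqs b

dequeued-deqs : ∀ b → dequeued (deqs b) ≡ dequeued b
dequeued-deqs []                              = refl
dequeued-deqs (mkEvent _ (enq _) ∷ b)        = dequeued-deqs b
dequeued-deqs (mkEvent _ (deq nothing) ∷ b)  = dequeued-deqs b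
dequeued-deqs (mkEvent _ (deq (just x)) ∷ b) = cong (x ∷_) (dequeued-deqs b)

enqs++deqs-↭ : ∀ b → b ↭ enqs b ++ deqs b
enqs++deqs-↭ [] = ↭-refl
enqs++deqs-↭ (mkEvent _ (enq _) ∷ b) = prep _ (enqs++deqs-↭ b)
enqs++deqs-↭ (e@(mkEvent _ (deq _)) ∷ b) =
  ↭-trans (prep e (enqs++deqs-↭ b)) (↭-sym (↭.shift e (enqs b) (deqs b)))

Enqueues⇒enqs≡id : ∀ {E} → Enqueues E → enqs E ≡ E
Enqueues⇒enqs≡id []       = refl
Enqueues⇒enqs≡id (enq∷ p) = cong (_ ∷_) (Enqueues⇒enqs≡id p)

Enqueues⇒deqs≡[] : ∀ {E} → Enqueues E → deqs E ≡ []
Enqueues⇒deqs≡[] []       = refl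
Enqueues⇒deqs≡[] (enq∷ p) = Enqueues⇒deqs≡[] p

Enqueues⇒EnqTail : ∀ {E} → Enqueues E → EnqTail E
Enqueues⇒EnqTail []                        = et-nil
Enqueues⇒EnqTail (enq∷_ {u = u} {x = x} p) = et-cons u x (Enqueues⇒EnqTail p)

-- The clause for an enqueue inside the dequeue list, and the one for a
-- value-returning dequeue with no pending enqueue, only make the function
-- total: neither arises when interleaving a legal behavior.
interleave : Behavior → Behavior → Behavior
interleave E       []                                = E
interleave E       (d@(mkEvent _ (deq nothing)) ∷ D)  = d ∷ interleave E D
interleave (e ∷ E) (d@(mkEvent _ (deq (just _))) ∷ D) = e ∷ d ∷ interleave E D
interleave []      (d@(mkEvent _ (deq (just _))) ∷ D) = d ∷ interleave [] D
interleave E       (d@(mkEvent _ (enq _)) ∷ D)        = d ∷ interleave E D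

interleave-↭ : ∀ E {D} → Dequeues D → interleave E D ↭ E ++ D
interleave-↭ E [] = ↭-sym (↭.++-identityʳ E)
interleave-↭ E (deq∷_ {m = nothing} {b = D} p) =
  ↭-trans (prep _ (interleave-↭ E p)) (↭-sym (↭.shift _ E D))
interleave-↭ [] (deq∷_ {m = just _} p) = prep _ (interleave-↭ [] p)
interleave-↭ (e ∷ E) (deq∷_ {m = just _} {b = D} p) =
  prep e (↭-trans (prep _ (interleave-↭ E p)) (↭-sym (↭.shift _ E D)))

enqs-interleave : ∀ {E D} → Enqueues E → Dequeues D → enqs (interleave E D) ≡ E
enqs-interleave pE        []                      = Enqueues⇒enqs≡id pE
enqs-interleave pE        (deq∷_ {m = nothing} pD) = enqs-interleave pE pD
enqs-interleave []        (deq∷_ {m = just _} pD)  = enqs-interleave [] pD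
enqs-interleave (enq∷ pE) (deq∷_ {m = just _} pD)  = cong (_ ∷_) (enqs-interleave pE pD)

deqs-interleave : ∀ {E D} → Enqueues E → Dequeues D → deqs (interleave E D) ≡ D
deqs-interleave pE        []                      = Enqueues⇒deqs≡[] pE
deqs-interleave pE        (deq∷_ {m = nothing} pD) = cong (_ ∷_) (deqs-interleave pE pD)
deqs-interleave []        (deq∷_ {m = just _} pD)  = cong (_ ∷_) (deqs-interleave [] pD)
deqs-interleave (enq∷ pE) (deq∷_ {m = just _} pD)  = cong (_ ∷_) (deqs-interleave pE pD)

interleave-Canonical : ∀ {E D r} → Enqueues E → Dequeues D →
  enqueued E ≡ dequeued D ++ r → Canonical (interleave E D)
interleave-Canonical pE [] _ = c-tail (Enqueues⇒EnqTail pE)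
interleave-Canonical pE (deq∷_ {u = u} {m = nothing} pD) eq =
  c-null u (interleave-Canonical pE pD eq)
interleave-Canonical [] (deq∷_ {m = just _} _) ()
interleave-Canonical (enq∷_ {u = v} {x = x} pE) (deq∷_ {u = u} {m = just _} pD) eq
  with refl , eq′ ← ∷-injective eq = c-pair v u x (interleave-Canonical pE pD eq′)

DuplicateFree-resp-↭ : ∀ {b b′} → b ↭ b′ → DuplicateFree b → DuplicateFree b′
DuplicateFree-resp-↭ p = ↭ₛ.Unique-resp-↭ (setoid ℕ) (↭⇒↭ₛ (↭.map⁺ uid p))

lemma3p2 : (b : Behavior) → DuplicateFree b → Legal b →
    Σ Behavior (λ bc → DuplicateFree bc × Canonical bc × ObsEquiv b bc)
lemma3p2 b dup-free (q , run) =
  interleave E D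
  , DuplicateFree-resp-↭ (↭-trans (enqs++deqs-↭ b) (↭-sym (interleave-↭ E pD))) dup-free
  , interleave-Canonical pE pD dequeued-prefix
  , sym (enqs-interleave pE pD)
  , sym (deqs-interleave pE pD)
  where
  E = enqs b
  D = deqs b
  pE = enqs-Enqueues b
  pD = deqs-Dequeues b
  dequeued-prefix : enqueued E ≡ dequeued D ++ q
  dequeued-prefix = begin
    enqueued E         ≡⟨ enqueued-enqs b ⟩
    [] ++ enqueued b   ≡⟨ run-balance run ⟩
    dequeued b ++ q    ≡⟨ cong (_++ q) (dequeued-deqs b) ⟨
    dequeued D ++ q    ∎
    where open ≡-Reasoning
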